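{- Let $n$ be a positive integer, $u\in S_n$, and $j$ an integer with $1\le j\le n-1$. Let $w\in B_n$ with $|w_1|\cdots|w_n|=u$ be such that the letters $w_1,\dots,w_{j+1}$ all have the same sign. Then, writing $\mathrm{wt}(v)=t^{\mathrm{fdes}(v)}q^{\mathrm{fmaj}(v)}$, \[ \mathrm{wt}(\Delta_j w)=\begin{cases} \mathrm{wt}(w)/(tq^j) & \text{if } j\in\mathrm{Des}(u),\\ \mathrm{wt}(w)\cdot tq^j & \text{if } j\notin \mathrm{Des}(u).\end{cases} \]
   Context: $[n]=\{1,\dots,n\}$, $S_n$ is the set of permutations of $[n]$, written as words. $B_n$ is the set of signed permutations: words $w=w_1\cdots w_n$ on the alphabet $\{\bar 1,1,\dots,\bar n,n\}$ (with $\bar i=-i$) such that $|w_1|\cdots|w_n|$ is a permutation in $S_n$. The alphabet is totally ordered by $\bar 1<\bar 2<\cdots<\bar n<1<2<\cdots<n$. For a word $w$ over a totally ordered alphabet, $\mathrm{Des}(w)=\{i : w_i>w_{i+1}\}$, $\mathrm{des}(w)=|\mathrm{Des}(w)|$, $\mathrm{maj}(w)=\sum_{i\in\mathrm{Des}(w)} i$. For $w\in B_n$: $\mathrm{fdes}(w)=2\,\mathrm{des}(w)+1$ if $w_1<0$ and $2\,\mathrm{des}(w)$ if $w_1>0$; $\mathrm{fmaj}(w)=2\,\mathrm{maj}(w)+|\{i: w_i<0\}|$. For $1\le i\le n$, $\Delta_i$ negates the first $i$ letters: $\Delta_i w=\overline{w_1}\cdots\overline{w_i}\,w_{i+1}\cdots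 w_n$ (with $\bar{\bar a}=a$). The weights are monomials in $t^{\pm1},q^{\pm1}$. -}

module Defs where

open import Data.Bool using (Bool; true; false; if_then_else_)
open import Data.Nat as ℕ using (ℕ; zero; suc)
open import Data.Integer as ℤ using (ℤ; +_; -_; ∣_∣; +0; -[1+_])
open import Data.Nat.ListAction using (sum)
open import Data.List using (List; []; _∷_; length; map; take; drop; _++_; filter; applyUpTo)
open import Data.List.Relation.Unary.All using (All)
open import Data.List.Relation.Binary.Permutation.Propositional using (_↭_)
open import Data.Product using (_×_; _,_)
open import Data.Sum using (_⊎_)
open import Relation.Nullary using (does)

IsPerm : ℕ → List ℕ → Set
IsPerm n u = u ↭ applyUpTo suc n

-- Descent positions (1-indexed) of a word, w.r.t. a strict-order test `lt`:
-- i is a descent iff w_{i+1} < w_i.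
descFrom : {A : Set} → (A → A → Bool) → ℕ → List A → List ℕ
descFrom lt k (a ∷ b ∷ r) =
  if lt b a then k ∷ descFrom lt (suc k) (b ∷ r) else descFrom lt (suc k) (b ∷ r)
descFrom lt k _ = []

ltℕ : ℕ → ℕ → Bool
ltℕ a b = does (a ℕ.<? b)

DesS : List ℕ → List ℕ
DesS = descFrom ltℕ 1

-- Order on signed letters:  1̄ < 2̄ < ⋯ < n̄ < 1 < 2 < ⋯ < n
-- (a negative letter -i is represented by the integer -i)
ltB : ℤ → ℤ → Bool
ltB (+ a)    (+ b)    = ltℕ a b
ltB (+ a)    -[1+ b ] = false
ltB -[1+ a ] (+ b)    = true
ltB -[1+ a ] -[1+ b ] = ltℕ a b

DesB : List ℤ → List ℕ
DesB = descFrom ltB 1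

desB : List ℤ → ℕ
desB w = length (DesB w)

majB : List ℤ → ℕ
majB w = sum (DesB w)

isNeg : ℤ → Bool
isNeg (+ _)    = false
isNeg -[1+ _ ] = true

negCount : List ℤ → ℕ
negCount [] = 0
negCount (x ∷ w) = if isNeg x then suc (negCount w) else negCount w

fdes : List ℤ → ℕ
fdes [] = 0
fdes (x ∷ w) = if isNeg x then suc (2 ℕ.* desB (x ∷ w)) else 2 ℕ.* desB (x ∷ w)

fmaj : List ℤ → ℕ
fmaj w = 2 ℕ.* majB w ℕ.+ negCount w

Δ : ℕ → List ℤ → List ℤ
Δ i w = map -_ (take i w) ++ drop i w

-- Laurent monomials t^a q^b in t^{±1}, q^{±1}, represented by their exponent pair (a , b)
Mono : Set
Mono = ℤ × ℤ

_·ₘ_ : Mono → Mono → Mono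
(a , b) ·ₘ (c , d) = (a ℤ.+ c , b ℤ.+ d)

_/ₘ_ : Mono → Mono → Mono
(a , b) /ₘ (c , d) = (a ℤ.- c , b ℤ.- d)

tq^ : ℕ → Mono
tq^ j = (+ 1 , + j)

wt : List ℤ → Mono
wt v = (+ fdes v , + fmaj v)

SameSign : List ℤ → Set
SameSign xs = All (λ x → x ℤ.< +0) xs ⊎ All (λ x → +0 ℤ.< x) xs

-- Write w = v y r, where the block v = w₁⋯w_j and the letter y = w_{j+1} all
-- have the same sign σ, so that Δ_j w = (-v) y r.  In the order 1̄<⋯<n̄<1<⋯<n
-- two letters of equal sign compare like their absolute values, and negating
-- both preserves this.  Hence the descent bits of w and Δ_j w (the 0/1 word
-- recording the descents) agree everywhere except at the junction j: there w
-- has the bit β = [j ∈ Des u], while Δ_j w has the bit σ = [w₁ < 0], because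
-- -w_j and y then have opposite signs.  The block contributes σ·j negative
-- letters to w and (1-σ)·j to Δ_j w, and the first letter has sign σ in w and
-- the opposite sign in Δ_j w.  Putting these together gives
--     fdes(Δ_j w) + 2β = fdes w + 1,    fmaj(Δ_j w) + 2βj = fmaj w + j,
-- which is the claim.
module Submission where

open import Defs
open import Data.Nat using (ℕ; suc; _≤_; _∸_)
open import Data.Integer using (ℤ; ∣_∣)
open import Data.List using (List; map; take)
open import Data.List.Membership.Propositional using (_∈_; _∉_)
open import Data.Product using (_×_)
open import Relation.Binary.PropositionalEquality using (_≡_)

open import Data.Bool using (Bool; true; false; not; if_then_else_)
open import Data.Bool.Properties using (¬-not)
open import Data.Nat using (zero; _+_; _*_; z≤n; s≤s)
open import Data.Nat.Properties
  using (≤-refl; <⇒≤; +-comm; <-irrefl; +-suc; +-identityʳ; +-cancelʳ-≡; m+1+n≢m; m≤n+m; m+n∸n≡m)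
open import Data.Nat.ListAction using (sum)
open import Data.Nat.ListAction.Properties using (sum-++)
open import Data.Nat.Tactic.RingSolver using (solve-∀)
open import Data.Integer using (+_; -[1+_]; +0; -_; _-_; +<+; -<+; _⊖_)
  renaming (_+_ to _+ℤ_; _<_ to _<ℤ_)
open import Data.Integer.Properties using (∣-i∣≡∣i∣; pos-+; [+m]-[+n]≡m⊖n; ⊖-≥)
open import Data.List using ([]; _∷_; _++_; length; [_])
open import Data.List.Properties using (map-++; length-map; length-++; length-applyUpTo)
open import Data.List.Relation.Unary.All using (All; []; _∷_)
import Data.List.Relation.Unary.All as All
open import Data.List.Relation.Unary.All.Properties using (map⁺; ++⁻ˡ; ++⁻ʳ)
open import Data.List.Relation.Unary.Any using (here; there)
open import Data.List.Relation.Binary.Permutation.Propositional.Properties using (↭-length)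
open import Data.Product using (Σ; _,_; proj₁; proj₂)
open import Data.Sum using (inj₁; inj₂)
open import Data.Empty using (⊥-elim)
open import Function using (_∘_)
open import Relation.Binary.PropositionalEquality using (refl; sym; trans; cong; cong₂; subst; subst₂)
open Relation.Binary.PropositionalEquality.≡-Reasoning

SignBit : Bool → ℤ → Set
SignBit true  x = x <ℤ +0
SignBit false x = +0 <ℤ x

sameSign-signBit : ∀ {v} → SameSign v → Σ Bool (λ σ → All (SignBit σ) v)
sameSign-signBit (inj₁ negative) = true , negative
sameSign-signBit (inj₂ positive) = false , positive

isNeg-signBit : ∀ {σ x} → SignBit σ x → isNeg x ≡ σ
isNeg-signBit {true}  { -[1+ _ ] } _ = refl
isNeg-signBit {true}  { + _ }      (+<+ ())
isNeg-signBit {false} { + _ }      _ = refl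
isNeg-signBit {false} { -[1+ _ ] } ()

signBit-negate : ∀ {σ x} → SignBit σ x → SignBit (not σ) (- x)
signBit-negate {true}  { -[1+ _ ] } _ = +<+ (s≤s z≤n)
signBit-negate {true}  { + _ }      (+<+ ())
signBit-negate {false} { + suc _ }  _ = -<+
signBit-negate {false} { + zero }   (+<+ ())
signBit-negate {false} { -[1+ _ ] } ()

ltB-abs : ∀ {σ x y} → SignBit σ x → SignBit σ y → ltB y x ≡ ltℕ ∣ y ∣ ∣ x ∣
ltB-abs {true}  { -[1+ _ ] } { -[1+ _ ] } _ _ = refl
ltB-abs {true}  { + _ }                  (+<+ ()) _
ltB-abs {true}  { -[1+ _ ] } { + _ }      _ (+<+ ())
ltB-abs {false} { + _ }      { + _ }      _ _ = refl
ltB-abs {false} { -[1+ _ ] }              () _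
ltB-abs {false} { + _ }      { -[1+ _ ] } _ ()

ltB-negate : ∀ {σ x y} → SignBit σ x → SignBit σ y → ltB (- y) (- x) ≡ ltB y x
ltB-negate {x = x} {y} sx sy = begin
  ltB (- y) (- x)           ≡⟨ ltB-abs (signBit-negate sx) (signBit-negate sy) ⟩
  ltℕ (∣ - y ∣) (∣ - x ∣)   ≡⟨ cong₂ ltℕ (∣-i∣≡∣i∣ y) (∣-i∣≡∣i∣ x) ⟩
  ltℕ ∣ y ∣ ∣ x ∣           ≡⟨ sym (ltB-abs sx sy) ⟩
  ltB y x                   ∎

-- If x and y have sign σ, then -x and y have opposite signs, so (-x, y) is a
-- descent exactly when -x is the positive one, i.e. when σ says "negative".
ltB-across : ∀ {σ x y} → SignBit σ x → SignBit σ y → ltB y (- x) ≡ σ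
ltB-across {true}  { -[1+ _ ] } { -[1+ _ ] } _ _ = refl
ltB-across {true}  { + _ }                  (+<+ ()) _
ltB-across {true}  { -[1+ _ ] } { + _ }      _ (+<+ ())
ltB-across {false} { + suc _ }  { + _ }      _ _ = refl
ltB-across {false} { + zero }               (+<+ ()) _
ltB-across {false} { -[1+ _ ] }              () _
ltB-across {false} { + _ }      { -[1+ _ ] } _ ()

_⊙_ : Bool → ℕ → ℕ
true  ⊙ m = m
false ⊙ m = 0

positions : ℕ → List Bool → List ℕ
positions k []           = []
positions k (true ∷ bs)  = k ∷ positions (suc k) bs
positions k (false ∷ bs) = positions (suc k) bs

positions-lower : ∀ k bs {m} → m ∈ positions k bs → k ≤ m
positions-lower k (true ∷ bs)  (here refl) = ≤-refl
positions-lower k (true ∷ bs)  (there mem) = <⇒≤ (positions-lower (suc k) bs mem)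
positions-lower k (false ∷ bs) mem         = <⇒≤ (positions-lower (suc k) bs mem)

positions-++ : ∀ k xs ys → positions k (xs ++ ys) ≡ positions k xs ++ positions (k + length xs) ys
positions-++ k []           ys = cong (λ i → positions i ys) (sym (+-identityʳ k))
positions-++ k (true ∷ xs)  ys =
  cong (k ∷_) (trans (positions-++ (suc k) xs ys)
                     (cong (λ i → positions (suc k) xs ++ positions i ys) (sym (+-suc k (length xs)))))
positions-++ k (false ∷ xs) ys =
  trans (positions-++ (suc k) xs ys)
        (cong (λ i → positions (suc k) xs ++ positions i ys) (sym (+-suc k (length xs))))

positions-at⁺ : ∀ k xs ys → k + length xs ∈ positions k (xs ++ true ∷ ys)
positions-at⁺ k []           ys = here (+-identityʳ k)
positions-at⁺ k (true ∷ xs)  ys =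
  there (subst (_∈ positions (suc k) (xs ++ true ∷ ys)) (sym (+-suc k (length xs))) (positions-at⁺ (suc k) xs ys))
positions-at⁺ k (false ∷ xs) ys =
  subst (_∈ positions (suc k) (xs ++ true ∷ ys)) (sym (+-suc k (length xs))) (positions-at⁺ (suc k) xs ys)

positions-at⁻ : ∀ k xs b ys → k + length xs ∈ positions k (xs ++ b ∷ ys) → b ≡ true
positions-at⁻ k []           true  ys _   = refl
positions-at⁻ k []           false ys mem =
  ⊥-elim (<-irrefl (sym (+-identityʳ k)) (positions-lower (suc k) ys mem))
positions-at⁻ k (true ∷ xs)  b ys (here eq)   = ⊥-elim (m+1+n≢m k eq)
positions-at⁻ k (true ∷ xs)  b ys (there mem) =
  positions-at⁻ (suc k) xs b ys (subst (_∈ positions (suc k) (xs ++ b ∷ ys)) (+-suc k (length xs)) mem)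
positions-at⁻ k (false ∷ xs) b ys mem =
  positions-at⁻ (suc k) xs b ys (subst (_∈ positions (suc k) (xs ++ b ∷ ys)) (+-suc k (length xs)) mem)

length-positions-split : ∀ k xs b ys →
  length (positions k (xs ++ b ∷ ys))
    ≡ length (positions k xs) + (b ⊙ 1 + length (positions (suc (k + length xs)) ys))
length-positions-split k xs b ys =
  trans (cong length (positions-++ k xs (b ∷ ys)))
        (trans (length-++ (positions k xs)) (cong (λ n → length (positions k xs) + n) (length-cons b)))
  where
  length-cons : ∀ b → length (positions (k + length xs) (b ∷ ys))
                    ≡ b ⊙ 1 + length (positions (suc (k + length xs)) ys)
  length-cons true  = refl
  length-cons false = refl

sum-positions-split : ∀ k xs b ys →
  sum (positions k (xs ++ b ∷ ys))
    ≡ sum (positions k xs) + (b ⊙ (k + length xs) + sum (positions (suc (k + length xs)) ys))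
sum-positions-split k xs b ys =
  trans (cong sum (positions-++ k xs (b ∷ ys)))
        (trans (sum-++ (positions k xs) _) (cong (λ n → sum (positions k xs) + n) (sum-cons b)))
  where
  sum-cons : ∀ b → sum (positions (k + length xs) (b ∷ ys))
                 ≡ b ⊙ (k + length xs) + sum (positions (suc (k + length xs)) ys)
  sum-cons true  = refl
  sum-cons false = refl

descBits : {A : Set} → (A → A → Bool) → List A → List Bool
descBits lt (a ∷ b ∷ r) = lt b a ∷ descBits lt (b ∷ r)
descBits lt _           = []

descFrom-positions : {A : Set} (lt : A → A → Bool) (k : ℕ) (w : List A) →
                     descFrom lt k w ≡ positions k (descBits lt w)
descFrom-positions lt k []          = refl
descFrom-positions lt k (a ∷ [])    = refl
descFrom-positions lt k (a ∷ b ∷ r) =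
  trans (cong (λ R → if lt b a then k ∷ R else R) (descFrom-positions lt (suc k) (b ∷ r)))
        (positions-cons (lt b a))
  where
  positions-cons : ∀ c → (if c then k ∷ positions (suc k) (descBits lt (b ∷ r))
                                else positions (suc k) (descBits lt (b ∷ r)))
                       ≡ positions k (c ∷ descBits lt (b ∷ r))
  positions-cons true  = refl
  positions-cons false = refl

descBits-junction : {A : Set} (lt : A → A → Bool) (p : List A) (x y : A) (r : List A) →
  descBits lt ((p ++ [ x ]) ++ y ∷ r) ≡ descBits lt (p ++ [ x ]) ++ lt y x ∷ descBits lt (y ∷ r)
descBits-junction lt []          x y r = refl
descBits-junction lt (a ∷ [])    x y r = refl
descBits-junction lt (a ∷ b ∷ p) x y r = cong (lt b a ∷_) (descBits-junction lt (b ∷ p) x y r)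

length-descBits : {A : Set} (lt : A → A → Bool) (p : List A) (x : A) →
                  suc (length (descBits lt (p ++ [ x ]))) ≡ length (p ++ [ x ])
length-descBits lt []          x = refl
length-descBits lt (a ∷ [])    x = refl
length-descBits lt (a ∷ b ∷ p) x = cong suc (length-descBits lt (b ∷ p) x)

descBits-map : {A B : Set} {P : A → Set} (f : A → B) (lt′ : B → B → Bool) (lt : A → A → Bool) →
  (∀ {a b} → P a → P b → lt′ (f b) (f a) ≡ lt b a) →
  ∀ {v} → All P v → descBits lt′ (map f v) ≡ descBits lt v
descBits-map f lt′ lt preserves []                  = refl
descBits-map f lt′ lt preserves (pa ∷ [])           = refl
descBits-map f lt′ lt preserves (pa ∷ pb ∷ signs) =
  cong₂ _∷_ (preserves pa pb) (descBits-map f lt′ lt preserves (pb ∷ signs))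

descBits-abs : ∀ {σ v} → All (SignBit σ) v → descBits ltℕ (map ∣_∣ v) ≡ descBits ltB v
descBits-abs = descBits-map ∣_∣ ltℕ ltB (λ sa sb → sym (ltB-abs sa sb))

descBits-negate : ∀ {σ v} → All (SignBit σ) v → descBits ltB (map -_ v) ≡ descBits ltB v
descBits-negate = descBits-map -_ ltB ltB ltB-negate

Δ-block : ∀ v r → Δ (length v) (v ++ r) ≡ map -_ v ++ r
Δ-block []      r = refl
Δ-block (a ∷ v) r = cong (- a ∷_) (Δ-block v r)

take-block : ∀ v (y : ℤ) r → take (suc (length v)) (v ++ y ∷ r) ≡ v ++ [ y ]
take-block []      y r = refl
take-block (a ∷ v) y r = cong (a ∷_) (take-block v y r)

negCount-block : ∀ {σ v} r → All (SignBit σ) v → negCount (v ++ r) ≡ σ ⊙ length v + negCount r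
negCount-block {true}  r [] = refl
negCount-block {false} r [] = refl
negCount-block {true}  r (sx ∷ signs) rewrite isNeg-signBit {true} sx = cong suc (negCount-block r signs)
negCount-block {false} r (sx ∷ signs) rewrite isNeg-signBit {false} sx = negCount-block r signs

fdes-head : ∀ {σ z} q → SignBit σ z → fdes (z ∷ q) ≡ 2 * desB (z ∷ q) + σ ⊙ 1
fdes-head {true}  q sz rewrite isNeg-signBit {true} sz = +-comm 1 (2 * desB (_ ∷ q))
fdes-head {false} q sz rewrite isNeg-signBit {false} sz = sym (+-identityʳ _)

fdes-block : ∀ {σ} p (x : ℤ) r → All (SignBit σ) (p ++ [ x ]) →
             fdes ((p ++ [ x ]) ++ r) ≡ 2 * desB ((p ++ [ x ]) ++ r) + σ ⊙ 1
fdes-block []      x r (sx ∷ _) = fdes-head r sx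
fdes-block (a ∷ p) x r (sa ∷ _) = fdes-head ((p ++ [ x ]) ++ r) sa

-- Arithmetic core of both shifts: the statistic of w has junction term b and sign
-- term σ·m + e, that of Δ_j w has junction term σ·m and sign term ¬σ·m + e;
-- then the weights  2·(statistic) + (sign term)  differ by m - 2b.
shift-arith : ∀ σ (a b c e m : ℕ) →
  2 * (a + (σ ⊙ m + c)) + (not σ ⊙ m + e) + 2 * b ≡ 2 * (a + (b + c)) + (σ ⊙ m + e) + m
shift-arith false = positive
  where
  positive : ∀ a b c e m → 2 * (a + (0 + c)) + (m + e) + 2 * b ≡ 2 * (a + (b + c)) + (0 + e) + m
  positive = solve-∀
shift-arith true = negative
  where
  negative : ∀ a b c e m → 2 * (a + (m + c)) + (0 + e) + 2 * b ≡ 2 * (a + (b + c)) + (m + e) + m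
  negative = solve-∀

module MonochromaticBlock {σ : Bool} (p : List ℤ) (x y : ℤ) (r : List ℤ)
                          (block-sign : All (SignBit σ) (p ++ [ x ])) (y-sign : SignBit σ y) where

  block : List ℤ
  block = p ++ [ x ]

  j : ℕ
  j = length block

  w : List ℤ
  w = block ++ y ∷ r

  β : Bool
  β = ltB y x

  -- descent bits shared by w and Δ_j w inside the block, and after y
  xs ys : List Bool
  xs = descBits ltB block
  ys = descBits ltB (y ∷ r)

  x-sign : SignBit σ x
  x-sign = All.head (++⁻ʳ p block-sign)

  junction : suc (length xs) ≡ j
  junction = length-descBits ltB p x

  flipped : List ℤ
  flipped = map -_ p ++ [ - x ]

  Δ-w : Δ j w ≡ flipped ++ y ∷ r
  Δ-w = trans (Δ-block block (y ∷ r)) (cong (_++ y ∷ r) (map-++ -_ p [ x ]))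

  flipped-sign : All (SignBit (not σ)) flipped
  flipped-sign = subst (All (SignBit (not σ))) (map-++ -_ p [ x ]) (map⁺ (All.map signBit-negate block-sign))

  flipped-length : length flipped ≡ j
  flipped-length = trans (cong length (sym (map-++ -_ p [ x ]))) (length-map -_ block)

  bits-w : DesB w ≡ positions 1 (xs ++ β ∷ ys)
  bits-w = trans (descFrom-positions ltB 1 w) (cong (positions 1) (descBits-junction ltB p x y r))

  bits-Δw : DesB (flipped ++ y ∷ r) ≡ positions 1 (xs ++ σ ∷ ys)
  bits-Δw = begin
    DesB (flipped ++ y ∷ r)
      ≡⟨ descFrom-positions ltB 1 (flipped ++ y ∷ r) ⟩
    positions 1 (descBits ltB (flipped ++ y ∷ r))
      ≡⟨ cong (positions 1) (descBits-junction ltB (map -_ p) (- x) y r) ⟩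
    positions 1 (descBits ltB flipped ++ ltB y (- x) ∷ ys)
      ≡⟨ cong₂ (λ zs c → positions 1 (zs ++ c ∷ ys)) flipped-bits (ltB-across x-sign y-sign) ⟩
    positions 1 (xs ++ σ ∷ ys) ∎
    where
    flipped-bits : descBits ltB flipped ≡ xs
    flipped-bits = trans (cong (descBits ltB) (sym (map-++ -_ p [ x ]))) (descBits-negate block-sign)

  module _ (W : List ℤ) (b : Bool) (bits : DesB W ≡ positions 1 (xs ++ b ∷ ys)) where
    des-split : desB W ≡ length (positions 1 xs) + (b ⊙ 1 + length (positions (suc (suc (length xs))) ys))
    des-split = trans (cong length bits) (length-positions-split 1 xs b ys)

    maj-split : majB W ≡ sum (positions 1 xs) + (b ⊙ j + sum (positions (suc (suc (length xs))) ys))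
    maj-split = trans (cong sum bits)
      (trans (sum-positions-split 1 xs b ys)
             (cong (λ i → sum (positions 1 xs) + (b ⊙ i + sum (positions (suc (suc (length xs))) ys))) junction))

  fdes-shift : fdes (Δ j w) + 2 * (β ⊙ 1) ≡ fdes w + 1
  fdes-shift = begin
    fdes (Δ j w) + 2 * (β ⊙ 1)
      ≡⟨ cong (λ v → fdes v + 2 * (β ⊙ 1)) Δ-w ⟩
    fdes (flipped ++ y ∷ r) + 2 * (β ⊙ 1)
      ≡⟨ cong (_+ 2 * (β ⊙ 1)) (fdes-block (map -_ p) (- x) (y ∷ r) flipped-sign) ⟩
    2 * desB (flipped ++ y ∷ r) + not σ ⊙ 1 + 2 * (β ⊙ 1)
      ≡⟨ cong (λ d → 2 * d + not σ ⊙ 1 + 2 * (β ⊙ 1)) (des-split (flipped ++ y ∷ r) σ bits-Δw) ⟩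
    2 * (a + (σ ⊙ 1 + c)) + not σ ⊙ 1 + 2 * (β ⊙ 1)
      ≡⟨ cong (λ e → 2 * (a + (σ ⊙ 1 + c)) + e + 2 * (β ⊙ 1)) (sym (+-identityʳ (not σ ⊙ 1))) ⟩
    2 * (a + (σ ⊙ 1 + c)) + (not σ ⊙ 1 + 0) + 2 * (β ⊙ 1)
      ≡⟨ shift-arith σ a (β ⊙ 1) c 0 1 ⟩
    2 * (a + (β ⊙ 1 + c)) + (σ ⊙ 1 + 0) + 1
      ≡⟨ cong (λ e → 2 * (a + (β ⊙ 1 + c)) + e + 1) (+-identityʳ (σ ⊙ 1)) ⟩
    2 * (a + (β ⊙ 1 + c)) + σ ⊙ 1 + 1
      ≡⟨ cong (λ d → 2 * d + σ ⊙ 1 + 1) (sym (des-split w β bits-w)) ⟩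
    2 * desB w + σ ⊙ 1 + 1
      ≡⟨ cong (_+ 1) (sym (fdes-block p x (y ∷ r) block-sign)) ⟩
    fdes w + 1 ∎
    where
    a c : ℕ
    a = length (positions 1 xs)
    c = length (positions (suc (suc (length xs))) ys)

  fmaj-shift : fmaj (Δ j w) + 2 * (β ⊙ j) ≡ fmaj w + j
  fmaj-shift = begin
    fmaj (Δ j w) + 2 * (β ⊙ j)
      ≡⟨ cong (λ v → fmaj v + 2 * (β ⊙ j)) Δ-w ⟩
    2 * majB (flipped ++ y ∷ r) + negCount (flipped ++ y ∷ r) + 2 * (β ⊙ j)
      ≡⟨ cong₂ (λ m n → 2 * m + n + 2 * (β ⊙ j)) (maj-split (flipped ++ y ∷ r) σ bits-Δw) negCount-Δw ⟩
    2 * (a + (σ ⊙ j + c)) + (not σ ⊙ j + R) + 2 * (β ⊙ j)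
      ≡⟨ shift-arith σ a (β ⊙ j) c R j ⟩
    2 * (a + (β ⊙ j + c)) + (σ ⊙ j + R) + j
      ≡⟨ cong₂ (λ m n → 2 * m + n + j) (sym (maj-split w β bits-w)) (sym (negCount-block (y ∷ r) block-sign)) ⟩
    fmaj w + j ∎
    where
    a c R : ℕ
    a = sum (positions 1 xs)
    c = sum (positions (suc (suc (length xs))) ys)
    R = negCount (y ∷ r)
    negCount-Δw : negCount (flipped ++ y ∷ r) ≡ not σ ⊙ j + R
    negCount-Δw = trans (negCount-block (y ∷ r) flipped-sign) (cong (λ i → not σ ⊙ i + R) flipped-length)

  bits-u : DesS (map ∣_∣ w) ≡ positions 1 (xs ++ β ∷ descBits ltℕ (map ∣_∣ (y ∷ r)))
  bits-u = begin
    DesS (map ∣_∣ w)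
      ≡⟨ descFrom-positions ltℕ 1 (map ∣_∣ w) ⟩
    positions 1 (descBits ltℕ (map ∣_∣ w))
      ≡⟨ cong (positions 1 ∘ descBits ltℕ) u-shape ⟩
    positions 1 (descBits ltℕ ((map ∣_∣ p ++ [ ∣ x ∣ ]) ++ ∣ y ∣ ∷ map ∣_∣ r))
      ≡⟨ cong (positions 1) (descBits-junction ltℕ (map ∣_∣ p) ∣ x ∣ ∣ y ∣ (map ∣_∣ r)) ⟩
    positions 1 (descBits ltℕ (map ∣_∣ p ++ [ ∣ x ∣ ]) ++ ltℕ ∣ y ∣ ∣ x ∣ ∷ descBits ltℕ (map ∣_∣ (y ∷ r)))
      ≡⟨ cong₂ (λ zs c → positions 1 (zs ++ c ∷ _)) abs-bits (sym (ltB-abs x-sign y-sign)) ⟩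
    positions 1 (xs ++ β ∷ descBits ltℕ (map ∣_∣ (y ∷ r))) ∎
    where
    u-shape : map ∣_∣ w ≡ (map ∣_∣ p ++ [ ∣ x ∣ ]) ++ ∣ y ∣ ∷ map ∣_∣ r
    u-shape = trans (map-++ ∣_∣ block (y ∷ r)) (cong (_++ ∣ y ∣ ∷ map ∣_∣ r) (map-++ ∣_∣ p [ x ]))
    abs-bits : descBits ltℕ (map ∣_∣ p ++ [ ∣ x ∣ ]) ≡ xs
    abs-bits = trans (cong (descBits ltℕ) (sym (map-++ ∣_∣ p [ x ]))) (descBits-abs block-sign)

  descent-at-j⁻ : j ∈ DesS (map ∣_∣ w) → β ≡ true
  descent-at-j⁻ mem = positions-at⁻ 1 xs β _ (subst₂ _∈_ (sym junction) bits-u mem)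

  descent-at-j⁺ : β ≡ true → j ∈ DesS (map ∣_∣ w)
  descent-at-j⁺ β-set =
    subst₂ _∈_ junction (sym bits-u)
      (subst (λ b → suc (length xs) ∈ positions 1 (xs ++ b ∷ _)) (sym β-set) (positions-at⁺ 1 xs _))

pos-+-minus : ∀ a c → + (a + c) - + c ≡ + a
pos-+-minus a c = begin
  + (a + c) - + c   ≡⟨ [+m]-[+n]≡m⊖n (a + c) c ⟩
  (a + c) ⊖ c       ≡⟨ ⊖-≥ (m≤n+m c a) ⟩
  + (a + c ∸ c)     ≡⟨ cong +_ (m+n∸n≡m a c) ⟩
  + a               ∎

shift-down : ∀ a′ a c → a′ + 2 * c ≡ a + c → + a′ ≡ + a - + c
shift-down a′ a c eq = begin
  + a′              ≡⟨ sym (pos-+-minus a′ c) ⟩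
  + (a′ + c) - + c  ≡⟨ cong (λ n → + n - + c) (+-cancelʳ-≡ c (a′ + c) a (trans (regroup a′ c) eq)) ⟩
  + a - + c         ∎
  where
  regroup : ∀ a′ c → a′ + c + c ≡ a′ + 2 * c
  regroup = solve-∀

shift-up : ∀ a′ a c → a′ + 2 * 0 ≡ a + c → + a′ ≡ + a +ℤ + c
shift-up a′ a c eq = trans (cong +_ (trans (sym (+-identityʳ a′)) eq)) (pos-+ a c)

monomial-shift : ∀ β {d d′ m m′ c : ℕ} → d′ + 2 * (β ⊙ 1) ≡ d + 1 → m′ + 2 * (β ⊙ c) ≡ m + c →
  (β ≡ true  → (+ d′ , + m′) ≡ (+ d , + m) /ₘ tq^ c) ×
  (β ≡ false → (+ d′ , + m′) ≡ (+ d , + m) ·ₘ tq^ c)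
monomial-shift true  {d} {d′} {m} {m′} {c} des-eq maj-eq =
  (λ _ → cong₂ _,_ (shift-down d′ d 1 des-eq) (shift-down m′ m c maj-eq)) , λ ()
monomial-shift false {d} {d′} {m} {m′} {c} des-eq maj-eq =
  (λ ()) , λ _ → cong₂ _,_ (shift-up d′ d 1 des-eq) (shift-up m′ m c maj-eq)

data Pivot {A : Set} (j : ℕ) : List A → Set where
  pivot : (p : List A) (x y : A) (r : List A) → length (p ++ [ x ]) ≡ j → Pivot j ((p ++ [ x ]) ++ y ∷ r)

pivot-view : ∀ {A : Set} j (w : List A) → 1 ≤ j → suc j ≤ length w → Pivot j w
pivot-view (suc zero)    (x ∷ y ∷ r) _ _ = pivot [] x y r refl
pivot-view (suc zero)    (x ∷ [])    _ (s≤s ())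
pivot-view (suc (suc i)) (a ∷ w)     _ (s≤s long) with pivot-view (suc i) w (s≤s z≤n) long
... | pivot p x y r eq = pivot (a ∷ p) x y r (cong suc eq)

perm-length : ∀ {n} (w : List ℤ) → IsPerm n (map ∣_∣ w) → length w ≡ n
perm-length {n} w perm = trans (sym (length-map ∣_∣ w)) (trans (↭-length perm) (length-applyUpTo suc n))

lemma8 : (n : ℕ) → 1 ≤ n → (u : List ℕ) → IsPerm n u →
         (j : ℕ) → 1 ≤ j → j ≤ n ∸ 1 →
         (w : List ℤ) → map ∣_∣ w ≡ u → SameSign (take (suc j) w) →
         (j ∈ DesS u → wt (Δ j w) ≡ wt w /ₘ tq^ j) ×
         (j ∉ DesS u → wt (Δ j w) ≡ wt w ·ₘ tq^ j)
lemma8 (suc n) _ _ perm j 1≤j j≤n w refl same-sign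
  with pivot-view j w 1≤j (subst (suc j ≤_) (sym (perm-length w perm)) (s≤s j≤n))
... | pivot p x y r refl
  with sameSign-signBit (subst SameSign (take-block (p ++ [ x ]) y r) same-sign)
... | σ , signs =
  (λ descent → proj₁ (monomial-shift β fdes-shift fmaj-shift) (descent-at-j⁻ descent)) ,
  (λ no-descent → proj₂ (monomial-shift β fdes-shift fmaj-shift) (¬-not (no-descent ∘ descent-at-j⁺)))
  where
  open MonochromaticBlock p x y r (++⁻ˡ (p ++ [ x ]) signs) (All.head (++⁻ʳ (p ++ [ x ]) signs))
    using (β; fdes-shift; fmaj-shift; descent-at-j⁻; descent-at-j⁺)
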